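{- $B_{\mathtt F}$ is projective in the variety of all closure algebras.
   Context: A closure algebra is a Boolean algebra with a map $f$ satisfying $f(0)=0$, $f(a+b)=f(a)+f(b)$, $a\le f(a)$, $f(f(a))\le f(a)$. $B_{\mathtt F}$ is the complex algebra of the fork: power set of $\{u,v,w\}$ with $f(X)=\{x:\exists y\in X,\ x\mathrel Ry\}$, $R$ the reflexive closure of $\{(u,v),(u,w)\}$. $B$ is projective in a variety $\mathbf V$ if for every $A\in\mathbf V$ and surjective homomorphism $p\colon A\to B$ there is a homomorphism $q\colon B\to A$ with $p\circ q=\mathrm{id}_B$. -}

module Defs where

open import Level using (Level; _⊔_) renaming (suc to lsuc)
open import Data.Bool using (Bool; true; false)
open import Data.Fin using (Fin; zero; suc)
open import Data.Fin.Properties using (_≟_; any?)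
open import Data.Fin.Subset using (Subset; _∈_)
open import Data.Fin.Subset.Properties using (_∈?_; ∪-∩-booleanAlgebra)
open import Data.Vec using (Vec; tabulate; _∷_; [])
open import Data.Product using (Σ; _×_; _,_)
open import Data.Sum using (_⊎_)
open import Relation.Nullary using (Dec; yes; no; does)
open import Relation.Nullary.Decidable using (_⊎-dec_; _×-dec_)
open import Relation.Binary.PropositionalEquality using (_≡_; refl)
open import Algebra.Lattice.Bundles using (BooleanAlgebra)

record ClosureAlgebra (c ℓ : Level) : Set (lsuc (c ⊔ ℓ)) where
  field
    booleanAlgebra : BooleanAlgebra c ℓ
  open BooleanAlgebra booleanAlgebra public
  _≤_ : Carrier → Carrier → Set ℓ
  a ≤ b = (a ∨ b) ≈ b
  field
    f       : Carrier → Carrier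
    f-cong  : ∀ {a b} → a ≈ b → f a ≈ f b
    f-zero  : f ⊥ ≈ ⊥
    f-join  : ∀ a b → f (a ∨ b) ≈ (f a ∨ f b)
    f-incr  : ∀ a → a ≤ f a
    f-idem  : ∀ a → f (f a) ≤ f a

open ClosureAlgebra using (Carrier)

record IsHomomorphism {c₁ ℓ₁ c₂ ℓ₂ : Level}
         (A : ClosureAlgebra c₁ ℓ₁) (B : ClosureAlgebra c₂ ℓ₂)
         (h : Carrier A → Carrier B) : Set (c₁ ⊔ ℓ₁ ⊔ ℓ₂) where
  private
    module A = ClosureAlgebra A
    module B = ClosureAlgebra B
  field
    cong   : ∀ {x y} → x A.≈ y → h x B.≈ h y
    ∨-hom  : ∀ x y → h (x A.∨ y) B.≈ (h x B.∨ h y)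
    ∧-hom  : ∀ x y → h (x A.∧ y) B.≈ (h x B.∧ h y)
    ¬-hom  : ∀ x → h (A.¬ x) B.≈ (B.¬ h x)
    ⊤-hom  : h A.⊤ B.≈ B.⊤
    ⊥-hom  : h A.⊥ B.≈ B.⊥
    f-hom  : ∀ x → h (A.f x) B.≈ B.f (h x)

Surjective : {c₁ ℓ₁ c₂ ℓ₂ : Level}
  (A : ClosureAlgebra c₁ ℓ₁) (B : ClosureAlgebra c₂ ℓ₂)
  (h : Carrier A → Carrier B) → Set (c₁ ⊔ c₂ ⊔ ℓ₂)
Surjective A B h = ∀ b → Σ (Carrier A) λ a → ClosureAlgebra._≈_ B (h a) b

Projective : {c₂ ℓ₂ : Level} (c₁ ℓ₁ : Level) (B : ClosureAlgebra c₂ ℓ₂) →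
  Set (lsuc (c₁ ⊔ ℓ₁) ⊔ c₂ ⊔ ℓ₂)
Projective c₁ ℓ₁ B =
  (A : ClosureAlgebra c₁ ℓ₁) (p : Carrier A → Carrier B) →
  IsHomomorphism A B p → Surjective A B p →
  Σ (Carrier B → Carrier A) λ q →
    IsHomomorphism B A q × (∀ b → ClosureAlgebra._≈_ B (p (q b)) b)

u v w : Fin 3
u = zero
v = suc zero
w = suc (suc zero)

data R₀ : Fin 3 → Fin 3 → Set where
  uv : R₀ u v
  uw : R₀ u w

R : Fin 3 → Fin 3 → Set
R x y = x ≡ y ⊎ R₀ x y

R₀? : ∀ x y → Dec (R₀ x y)
R₀? zero zero = no λ ()
R₀? zero (suc zero) = yes uv
R₀? zero (suc (suc zero)) = yes uw
R₀? (suc x) y = no λ ()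

R? : ∀ x y → Dec (R x y)
R? x y = (x ≟ y) ⊎-dec R₀? x y

fF : Subset 3 → Subset 3
fF X = tabulate λ x → does (any? λ y → R? x y ×-dec (y ∈? X))

private
  BA3 : BooleanAlgebra _ _
  BA3 = ∪-∩-booleanAlgebra 3

  open BooleanAlgebra BA3 using (_∨_)

  fF-join : ∀ a b → fF (a ∨ b) ≡ (fF a ∨ fF b)
  fF-join (true ∷ true ∷ true ∷ []) (true ∷ true ∷ true ∷ []) = refl
  fF-join (true ∷ true ∷ true ∷ []) (true ∷ true ∷ false ∷ []) = refl
  fF-join (true ∷ true ∷ true ∷ []) (true ∷ false ∷ true ∷ []) = refl
  fF-join (true ∷ true ∷ true ∷ []) (true ∷ false ∷ false ∷ []) = refl
  fF-join (true ∷ true ∷ true ∷ []) (false ∷ true ∷ true ∷ []) = refl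
  fF-join (true ∷ true ∷ true ∷ []) (false ∷ true ∷ false ∷ []) = refl
  fF-join (true ∷ true ∷ true ∷ []) (false ∷ false ∷ true ∷ []) = refl
  fF-join (true ∷ true ∷ true ∷ []) (false ∷ false ∷ false ∷ []) = refl
  fF-join (true ∷ true ∷ false ∷ []) (true ∷ true ∷ true ∷ []) = refl
  fF-join (true ∷ true ∷ false ∷ []) (true ∷ true ∷ false ∷ []) = refl
  fF-join (true ∷ true ∷ false ∷ []) (true ∷ false ∷ true ∷ []) = refl
  fF-join (true ∷ true ∷ false ∷ []) (true ∷ false ∷ false ∷ []) = refl
  fF-join (true ∷ true ∷ false ∷ []) (false ∷ true ∷ true ∷ []) = refl
  fF-join (true ∷ true ∷ false ∷ []) (false ∷ true ∷ false ∷ []) = refl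
  fF-join (true ∷ true ∷ false ∷ []) (false ∷ false ∷ true ∷ []) = refl
  fF-join (true ∷ true ∷ false ∷ []) (false ∷ false ∷ false ∷ []) = refl
  fF-join (true ∷ false ∷ true ∷ []) (true ∷ true ∷ true ∷ []) = refl
  fF-join (true ∷ false ∷ true ∷ []) (true ∷ true ∷ false ∷ []) = refl
  fF-join (true ∷ false ∷ true ∷ []) (true ∷ false ∷ true ∷ []) = refl
  fF-join (true ∷ false ∷ true ∷ []) (true ∷ false ∷ false ∷ []) = refl
  fF-join (true ∷ false ∷ true ∷ []) (false ∷ true ∷ true ∷ []) = refl
  fF-join (true ∷ false ∷ true ∷ []) (false ∷ true ∷ false ∷ []) = refl
  fF-join (true ∷ false ∷ true ∷ []) (false ∷ false ∷ true ∷ []) = refl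
  fF-join (true ∷ false ∷ true ∷ []) (false ∷ false ∷ false ∷ []) = refl
  fF-join (true ∷ false ∷ false ∷ []) (true ∷ true ∷ true ∷ []) = refl
  fF-join (true ∷ false ∷ false ∷ []) (true ∷ true ∷ false ∷ []) = refl
  fF-join (true ∷ false ∷ false ∷ []) (true ∷ false ∷ true ∷ []) = refl
  fF-join (true ∷ false ∷ false ∷ []) (true ∷ false ∷ false ∷ []) = refl
  fF-join (true ∷ false ∷ false ∷ []) (false ∷ true ∷ true ∷ []) = refl
  fF-join (true ∷ false ∷ false ∷ []) (false ∷ true ∷ false ∷ []) = refl
  fF-join (true ∷ false ∷ false ∷ []) (false ∷ false ∷ true ∷ []) = refl
  fF-join (true ∷ false ∷ false ∷ []) (false ∷ false ∷ false ∷ []) = refl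
  fF-join (false ∷ true ∷ true ∷ []) (true ∷ true ∷ true ∷ []) = refl
  fF-join (false ∷ true ∷ true ∷ []) (true ∷ true ∷ false ∷ []) = refl
  fF-join (false ∷ true ∷ true ∷ []) (true ∷ false ∷ true ∷ []) = refl
  fF-join (false ∷ true ∷ true ∷ []) (true ∷ false ∷ false ∷ []) = refl
  fF-join (false ∷ true ∷ true ∷ []) (false ∷ true ∷ true ∷ []) = refl
  fF-join (false ∷ true ∷ true ∷ []) (false ∷ true ∷ false ∷ []) = refl
  fF-join (false ∷ true ∷ true ∷ []) (false ∷ false ∷ true ∷ []) = refl
  fF-join (false ∷ true ∷ true ∷ []) (false ∷ false ∷ false ∷ []) = refl
  fF-join (false ∷ true ∷ false ∷ []) (true ∷ true ∷ true ∷ []) = refl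
  fF-join (false ∷ true ∷ false ∷ []) (true ∷ true ∷ false ∷ []) = refl
  fF-join (false ∷ true ∷ false ∷ []) (true ∷ false ∷ true ∷ []) = refl
  fF-join (false ∷ true ∷ false ∷ []) (true ∷ false ∷ false ∷ []) = refl
  fF-join (false ∷ true ∷ false ∷ []) (false ∷ true ∷ true ∷ []) = refl
  fF-join (false ∷ true ∷ false ∷ []) (false ∷ true ∷ false ∷ []) = refl
  fF-join (false ∷ true ∷ false ∷ []) (false ∷ false ∷ true ∷ []) = refl
  fF-join (false ∷ true ∷ false ∷ []) (false ∷ false ∷ false ∷ []) = refl
  fF-join (false ∷ false ∷ true ∷ []) (true ∷ true ∷ true ∷ []) = refl
  fF-join (false ∷ false ∷ true ∷ []) (true ∷ true ∷ false ∷ []) = refl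
  fF-join (false ∷ false ∷ true ∷ []) (true ∷ false ∷ true ∷ []) = refl
  fF-join (false ∷ false ∷ true ∷ []) (true ∷ false ∷ false ∷ []) = refl
  fF-join (false ∷ false ∷ true ∷ []) (false ∷ true ∷ true ∷ []) = refl
  fF-join (false ∷ false ∷ true ∷ []) (false ∷ true ∷ false ∷ []) = refl
  fF-join (false ∷ false ∷ true ∷ []) (false ∷ false ∷ true ∷ []) = refl
  fF-join (false ∷ false ∷ true ∷ []) (false ∷ false ∷ false ∷ []) = refl
  fF-join (false ∷ false ∷ false ∷ []) (true ∷ true ∷ true ∷ []) = refl
  fF-join (false ∷ false ∷ false ∷ []) (true ∷ true ∷ false ∷ []) = refl
  fF-join (false ∷ false ∷ false ∷ []) (true ∷ false ∷ true ∷ []) = refl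
  fF-join (false ∷ false ∷ false ∷ []) (true ∷ false ∷ false ∷ []) = refl
  fF-join (false ∷ false ∷ false ∷ []) (false ∷ true ∷ true ∷ []) = refl
  fF-join (false ∷ false ∷ false ∷ []) (false ∷ true ∷ false ∷ []) = refl
  fF-join (false ∷ false ∷ false ∷ []) (false ∷ false ∷ true ∷ []) = refl
  fF-join (false ∷ false ∷ false ∷ []) (false ∷ false ∷ false ∷ []) = refl

  fF-incr : ∀ a → (a ∨ fF a) ≡ fF a
  fF-incr (true ∷ true ∷ true ∷ []) = refl
  fF-incr (true ∷ true ∷ false ∷ []) = refl
  fF-incr (true ∷ false ∷ true ∷ []) = refl
  fF-incr (true ∷ false ∷ false ∷ []) = refl
  fF-incr (false ∷ true ∷ true ∷ []) = refl
  fF-incr (false ∷ true ∷ false ∷ []) = refl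
  fF-incr (false ∷ false ∷ true ∷ []) = refl
  fF-incr (false ∷ false ∷ false ∷ []) = refl

  fF-idem : ∀ a → (fF (fF a) ∨ fF a) ≡ fF a
  fF-idem (true ∷ true ∷ true ∷ []) = refl
  fF-idem (true ∷ true ∷ false ∷ []) = refl
  fF-idem (true ∷ false ∷ true ∷ []) = refl
  fF-idem (true ∷ false ∷ false ∷ []) = refl
  fF-idem (false ∷ true ∷ true ∷ []) = refl
  fF-idem (false ∷ true ∷ false ∷ []) = refl
  fF-idem (false ∷ false ∷ true ∷ []) = refl
  fF-idem (false ∷ false ∷ false ∷ []) = refl

B-F : ClosureAlgebra _ _
B-F = record
  { booleanAlgebra = ∪-∩-booleanAlgebra 3
  ; f      = fF
  ; f-cong = λ { refl → refl }
  ; f-zero = refl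
  ; f-join = fF-join
  ; f-incr = fF-incr
  ; f-idem = fF-idem
  }

{-# OPTIONS --safe #-}
module Submission where

-- Every element x of a closure algebra A yields two closed elements
-- a = f (¬ f x) and b = f (¬ a) with ¬ a ≤ b, a ≤ f (a ∧ ¬ b) and b ≤ f (b ∧ ¬ a).
-- Hence the atoms a ∧ b, a ∧ ¬ b, b ∧ ¬ a partition ⊤ and f acts on them as on the
-- points u, v, w of the fork, so X ↦ ⋁_{i ∈ X} eᵢ is a homomorphism q_x : B_F → A.
-- The construction commutes with homomorphisms, and q_{w} is the identity of B_F.
-- Given a surjection p : A → B_F, pick x with p x = {w}; then p ∘ q_x = q_{p x} = id.

open import Defs

open import Level using (Level)
open import Function using (_∘_)
open import Data.Empty using (⊥-elim)
open import Data.Product using (_,_; proj₁; proj₂)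
open import Data.Nat as ℕ using ()
open import Data.Bool using (true; false; if_then_else_)
  renaming (_∨_ to _∨ᵇ_; _∧_ to _∧ᵇ_)
open import Data.Fin using (Fin; zero; suc)
open import Data.Fin.Properties using (suc-injective)
open import Data.Fin.Subset as Subset using (Subset; ⁅_⁆; _∪_; _∩_; ∁)
open import Data.Fin.Subset.Properties using (∪-∩-booleanAlgebra; ∪-inverseʳ; ∩-inverseʳ; ∪-identityˡ)
open import Data.Vec using (_∷_; []; lookup)
open import Relation.Binary.PropositionalEquality as ≡ using (_≡_; _≢_)
open import Relation.Binary.Bundles using (Poset)
import Relation.Binary.Lattice as Order
import Relation.Binary.Lattice.Properties.JoinSemilattice as JoinSemilatticeProperties
import Relation.Binary.Lattice.Properties.MeetSemilattice as MeetSemilatticeProperties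
open import Algebra.Bundles using (CommutativeSemiring)
open import Algebra.Lattice.Bundles using (BooleanAlgebra)
import Algebra.Lattice.Properties.BooleanAlgebra as BooleanAlgebraProperties

module BooleanAlgebraOrder {c ℓ : Level} (B : BooleanAlgebra c ℓ) where
  open BooleanAlgebra B
  open BooleanAlgebraProperties B
  open import Relation.Binary.Reasoning.Setoid setoid

  open Order.Lattice ∨-∧-orderTheoreticLattice public
    using (_≤_; x≤x∨y; y≤x∨y; ∨-least; x∧y≤x; x∧y≤y; ∧-greatest)
  open Poset poset public
    using () renaming (refl to ≤-refl; trans to ≤-trans; antisym to ≤-antisym; reflexive to ≤-reflexive)
  open JoinSemilatticeProperties (Order.Lattice.joinSemilattice ∨-∧-orderTheoreticLattice) public
    using (x≤y⇒x∨y≈y)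
  open MeetSemilatticeProperties (Order.Lattice.meetSemilattice ∨-∧-orderTheoreticLattice) public
    using (∧-monotonic)

  x∨y≈y⇒x≤y : ∀ {x y} → x ∨ y ≈ y → x ≤ y
  x∨y≈y⇒x≤y {x} {y} x∨y≈y = ≤-trans (x≤x∨y x y) (≤-reflexive x∨y≈y)

  x≤⊤ : ∀ x → x ≤ ⊤
  x≤⊤ x = sym (∧-identityʳ x)

  x≤⊥⇒x≈⊥ : ∀ {x} → x ≤ ⊥ → x ≈ ⊥
  x≤⊥⇒x≈⊥ {x} x≈x∧⊥ = trans x≈x∧⊥ (∧-zeroʳ x)

  ¬-antitone : ∀ {x y} → x ≤ y → ¬ y ≤ ¬ x
  ¬-antitone {x} {y} x≤y = begin
    ¬ y            ≈⟨ ¬-cong (x≤y⇒x∨y≈y x≤y) ⟨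
    ¬ (x ∨ y)      ≈⟨ deMorgan₂ x y ⟩
    ¬ x ∧ ¬ y      ≈⟨ ∧-comm (¬ x) (¬ y) ⟩
    ¬ y ∧ ¬ x      ∎

  ¬x≤y⇒¬y≤x : ∀ {x y} → ¬ x ≤ y → ¬ y ≤ x
  ¬x≤y⇒¬y≤x {x} ¬x≤y = ≤-trans (¬-antitone ¬x≤y) (≤-reflexive (¬-involutive x))

  ¬x≤y⇒x∨y≈⊤ : ∀ {x y} → ¬ x ≤ y → x ∨ y ≈ ⊤
  ¬x≤y⇒x∨y≈⊤ {x} {y} ¬x≤y = ≤-antisym (x≤⊤ (x ∨ y)) (≤-trans
    (≤-reflexive (sym (∨-complementʳ x)))
    (∨-least (x≤x∨y x y) (≤-trans ¬x≤y (y≤x∨y x y))))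

  ≤-¬-disjoint : ∀ {x y z} → x ≤ y → z ≤ ¬ y → x ∧ z ≈ ⊥
  ≤-¬-disjoint {y = y} x≤y z≤¬y =
    x≤⊥⇒x≈⊥ (≤-trans (∧-monotonic x≤y z≤¬y) (≤-reflexive (∧-complementʳ y)))

  ∧-¬-split : ∀ x y → (x ∧ y) ∨ (x ∧ ¬ y) ≈ x
  ∧-¬-split x y = begin
    (x ∧ y) ∨ (x ∧ ¬ y) ≈⟨ ∧-distribˡ-∨ x y (¬ y) ⟨
    x ∧ (y ∨ ¬ y)       ≈⟨ ∧-congˡ (∨-complementʳ y) ⟩
    x ∧ ⊤               ≈⟨ ∧-identityʳ x ⟩
    x                   ∎

  complement-unique : ∀ {x y} → x ∧ y ≈ ⊥ → x ∨ y ≈ ⊤ → y ≈ ¬ x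
  complement-unique {x} {y} x∧y≈⊥ x∨y≈⊤ =
    ≤-antisym (below y x∧y≈⊥ (∨-complementʳ x)) (below (¬ x) (∧-complementʳ x) x∨y≈⊤)
    where
    below : ∀ z {t} → x ∧ z ≈ ⊥ → x ∨ t ≈ ⊤ → z ≤ t
    below z {t} x∧z≈⊥ x∨t≈⊤ = sym (begin
      z ∧ t                 ≈⟨ ∨-identityˡ (z ∧ t) ⟨
      ⊥ ∨ (z ∧ t)           ≈⟨ ∨-congʳ (trans (∧-comm z x) x∧z≈⊥) ⟨
      (z ∧ x) ∨ (z ∧ t)     ≈⟨ ∧-distribˡ-∨ z x t ⟨
      z ∧ (x ∨ t)           ≈⟨ ∧-congˡ x∨t≈⊤ ⟩
      z ∧ ⊤                 ≈⟨ ∧-identityʳ z ⟩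
      z                     ∎)

module Join {c ℓ : Level} (B : BooleanAlgebra c ℓ) where
  open BooleanAlgebra B
  open BooleanAlgebraProperties B
  open import Algebra.Properties.CommutativeSemigroup
    (CommutativeSemiring.+-commutativeSemigroup ∨-∧-commutativeSemiring) using (interchange)

  ⋁ : ∀ {n} → (Fin n → Carrier) → Subset n → Carrier
  ⋁ e []      = ⊥
  ⋁ e (b ∷ X) = (if b then e zero else ⊥) ∨ ⋁ (e ∘ suc) X

  if-∨ : ∀ a b x → (if a ∨ᵇ b then x else ⊥) ≈ (if a then x else ⊥) ∨ (if b then x else ⊥)
  if-∨ true  true  x = sym (∨-idem x)
  if-∨ true  false x = sym (∨-identityʳ x)
  if-∨ false b     x = sym (∨-identityˡ _)

  ⋁-cong : ∀ {n} {e e′ : Fin n → Carrier} → (∀ i → e i ≈ e′ i) → ∀ X → ⋁ e X ≈ ⋁ e′ X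
  ⋁-cong e≈e′ []          = refl
  ⋁-cong e≈e′ (true ∷ X)  = ∨-cong (e≈e′ zero) (⋁-cong (e≈e′ ∘ suc) X)
  ⋁-cong e≈e′ (false ∷ X) = ∨-congˡ (⋁-cong (e≈e′ ∘ suc) X)

  ⋁-⊥ : ∀ {n} (e : Fin n → Carrier) → ⋁ e Subset.⊥ ≈ ⊥
  ⋁-⊥ {ℕ.zero}  e = refl
  ⋁-⊥ {ℕ.suc n} e = trans (∨-identityˡ _) (⋁-⊥ (e ∘ suc))

  ⋁-∪ : ∀ {n} (e : Fin n → Carrier) X Y → ⋁ e (X ∪ Y) ≈ ⋁ e X ∨ ⋁ e Y
  ⋁-∪ e []      []      = sym (∨-idem ⊥)
  ⋁-∪ e (a ∷ X) (b ∷ Y) =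
    trans (∨-cong (if-∨ a b (e zero)) (⋁-∪ (e ∘ suc) X Y)) (interchange _ _ _ _)

  ⋁-⁅⁆ : ∀ {n} (e : Fin n → Carrier) i → ⋁ e ⁅ i ⁆ ≈ e i
  ⋁-⁅⁆ e zero    = trans (∨-congˡ (⋁-⊥ (e ∘ suc))) (∨-identityʳ (e zero))
  ⋁-⁅⁆ e (suc i) = trans (∨-identityˡ _) (⋁-⁅⁆ (e ∘ suc) i)

  ⋁-⁅⁆∪⁅⁆ : ∀ {n} (e : Fin n → Carrier) i j → ⋁ e (⁅ i ⁆ ∪ ⁅ j ⁆) ≈ e i ∨ e j
  ⋁-⁅⁆∪⁅⁆ e i j = trans (⋁-∪ e ⁅ i ⁆ ⁅ j ⁆) (∨-cong (⋁-⁅⁆ e i) (⋁-⁅⁆ e j))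

module _ {c₁ ℓ₁ c₂ ℓ₂ : Level} (B₁ : BooleanAlgebra c₁ ℓ₁) (B₂ : BooleanAlgebra c₂ ℓ₂) where
  private
    module B₁ = BooleanAlgebra B₁
    module B₂ = BooleanAlgebra B₂
  open Join using (⋁)

  ⋁-natural : (h : B₁.Carrier → B₂.Carrier) → h B₁.⊥ B₂.≈ B₂.⊥ →
              (∀ x y → h (x B₁.∨ y) B₂.≈ (h x B₂.∨ h y)) →
              ∀ {n} (e : Fin n → B₁.Carrier) X → h (⋁ B₁ e X) B₂.≈ ⋁ B₂ (h ∘ e) X
  ⋁-natural h h-⊥ h-∨ e []      = h-⊥
  ⋁-natural h h-⊥ h-∨ e (b ∷ X) =
    B₂.trans (h-∨ _ _) (B₂.∨-cong (h-if b) (⋁-natural h h-⊥ h-∨ (e ∘ suc) X))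
    where
    h-if : ∀ b → h (if b then e zero else B₁.⊥) B₂.≈ (if b then h (e zero) else B₂.⊥)
    h-if true  = B₂.refl
    h-if false = h-⊥

module Partition {c ℓ : Level} (B : BooleanAlgebra c ℓ) where
  open BooleanAlgebra B
  open BooleanAlgebraProperties B
  open BooleanAlgebraOrder B using (complement-unique)
  open Join B
  open import Relation.Binary.Reasoning.Setoid setoid

  Disjoint : ∀ {n} → (Fin n → Carrier) → Set ℓ
  Disjoint e = ∀ {i j} → i ≢ j → e i ∧ e j ≈ ⊥

  record IsPartition {n} (e : Fin n → Carrier) : Set ℓ where
    field
      disjoint : Disjoint e
      cover    : ⋁ e Subset.⊤ ≈ ⊤

  ⋁-∧ˡ : ∀ x {n} (e : Fin n → Carrier) X → x ∧ ⋁ e X ≈ ⋁ (λ i → x ∧ e i) X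
  ⋁-∧ˡ x = ⋁-natural B B (x ∧_) (∧-zeroʳ x) (∧-distribˡ-∨ x)

  if-∧-self : ∀ b x → (if b then x else ⊥) ∧ x ≈ (if b then x else ⊥)
  if-∧-self true  x = ∧-idem x
  if-∧-self false x = ∧-zeroˡ x

  if-∧-⊥ : ∀ b {x y} → x ∧ y ≈ ⊥ → (if b then x else ⊥) ∧ y ≈ ⊥
  if-∧-⊥ true      x∧y≈⊥ = x∧y≈⊥
  if-∧-⊥ false {y = y} _ = ∧-zeroˡ y

  if-if : ∀ s t x → (if t then (if s then x else ⊥) else ⊥) ≡ (if s ∧ᵇ t then x else ⊥)
  if-if true  t     x = ≡.refl
  if-if false true  x = ≡.refl
  if-if false false x = ≡.refl

  ⋁-∧-disjoint : ∀ {n} {e : Fin n → Carrier} {x} → (∀ i → e i ∧ x ≈ ⊥) → ∀ X → ⋁ e X ∧ x ≈ ⊥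
  ⋁-∧-disjoint {x = x} e∧x≈⊥ []      = ∧-zeroˡ x
  ⋁-∧-disjoint {e = e} {x} e∧x≈⊥ (b ∷ X) = begin
    ((if b then e zero else ⊥) ∨ ⋁ (e ∘ suc) X) ∧ x
      ≈⟨ ∧-distribʳ-∨ x _ _ ⟩
    ((if b then e zero else ⊥) ∧ x) ∨ (⋁ (e ∘ suc) X ∧ x)
      ≈⟨ ∨-cong (if-∧-⊥ b (e∧x≈⊥ zero)) (⋁-∧-disjoint (e∧x≈⊥ ∘ suc) X) ⟩
    ⊥ ∨ ⊥
      ≈⟨ ∨-idem ⊥ ⟩
    ⊥ ∎

  ⋁-∧-atom : ∀ {n} {e : Fin n → Carrier} → Disjoint e → ∀ X i →
             ⋁ e X ∧ e i ≈ (if lookup X i then e i else ⊥)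
  ⋁-∧-atom {e = e} disjoint (b ∷ X) zero = begin
    ((if b then e zero else ⊥) ∨ ⋁ (e ∘ suc) X) ∧ e zero
      ≈⟨ ∧-distribʳ-∨ (e zero) _ _ ⟩
    ((if b then e zero else ⊥) ∧ e zero) ∨ (⋁ (e ∘ suc) X ∧ e zero)
      ≈⟨ ∨-cong (if-∧-self b (e zero)) (⋁-∧-disjoint (λ _ → disjoint λ ()) X) ⟩
    (if b then e zero else ⊥) ∨ ⊥
      ≈⟨ ∨-identityʳ _ ⟩
    (if b then e zero else ⊥) ∎
  ⋁-∧-atom {e = e} disjoint (b ∷ X) (suc i) = begin
    ((if b then e zero else ⊥) ∨ ⋁ (e ∘ suc) X) ∧ e (suc i)
      ≈⟨ ∧-distribʳ-∨ (e (suc i)) _ _ ⟩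
    ((if b then e zero else ⊥) ∧ e (suc i)) ∨ (⋁ (e ∘ suc) X ∧ e (suc i))
      ≈⟨ ∨-cong (if-∧-⊥ b (disjoint λ ())) (⋁-∧-atom (λ i≢j → disjoint (i≢j ∘ suc-injective)) X i) ⟩
    ⊥ ∨ (if lookup X i then e (suc i) else ⊥)
      ≈⟨ ∨-identityˡ _ ⟩
    (if lookup X i then e (suc i) else ⊥) ∎

  ⋁-masked : ∀ {n} (e : Fin n → Carrier) X Y → ⋁ (λ i → if lookup X i then e i else ⊥) Y ≈ ⋁ e (X ∩ Y)
  ⋁-masked e []      []      = refl
  ⋁-masked e (s ∷ X) (t ∷ Y) = ∨-cong (reflexive (if-if s t (e zero))) (⋁-masked (e ∘ suc) X Y)

  ⋁-∩ : ∀ {n} {e : Fin n → Carrier} → Disjoint e → ∀ X Y → ⋁ e (X ∩ Y) ≈ ⋁ e X ∧ ⋁ e Y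
  ⋁-∩ {e = e} disjoint X Y = sym (begin
    ⋁ e X ∧ ⋁ e Y                                  ≈⟨ ⋁-∧ˡ (⋁ e X) e Y ⟩
    ⋁ (λ i → ⋁ e X ∧ e i) Y                        ≈⟨ ⋁-cong (⋁-∧-atom disjoint X) Y ⟩
    ⋁ (λ i → if lookup X i then e i else ⊥) Y      ≈⟨ ⋁-masked e X Y ⟩
    ⋁ e (X ∩ Y)                                    ∎)

  ⋁-∁ : ∀ {n} {e : Fin n → Carrier} → IsPartition e → ∀ X → ⋁ e (∁ X) ≈ ¬ ⋁ e X
  ⋁-∁ {e = e} partition X = complement-unique
    (trans (sym (⋁-∩ disjoint X (∁ X))) (trans (reflexive (≡.cong (⋁ e) (∩-inverseʳ X))) (⋁-⊥ e)))
    (trans (sym (⋁-∪ e X (∁ X))) (trans (reflexive (≡.cong (⋁ e) (∪-inverseʳ X))) cover))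
    where open IsPartition partition

⋃ : ∀ {n m} → (Fin n → Subset m) → Subset n → Subset m
⋃ {m = m} = Join.⋁ (∪-∩-booleanAlgebra m)

⋃-⁅⁆ : ∀ {n} (X : Subset n) → ⋃ ⁅_⁆ X ≡ X
⋃-⁅⁆ []      = ≡.refl
⋃-⁅⁆ (b ∷ X) = ≡.trans (≡.cong ((if b then ⁅ zero ⁆ else Subset.⊥) ∪_) ⋃-⁅suc⁆) (⋃-head b)
  where
  ⋃-⁅suc⁆ : ⋃ (⁅_⁆ ∘ suc) X ≡ false ∷ X
  ⋃-⁅suc⁆ = ≡.trans (≡.sym (⋁-natural (∪-∩-booleanAlgebra _) (∪-∩-booleanAlgebra _)
                       (false ∷_) ≡.refl (λ _ _ → ≡.refl) ⁅_⁆ X))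
                     (≡.cong (false ∷_) (⋃-⁅⁆ X))
  ⋃-head : ∀ b → (if b then ⁅ zero ⁆ else Subset.⊥) ∪ (false ∷ X) ≡ b ∷ X
  ⋃-head true  = ≡.cong (true ∷_) (∪-identityˡ X)
  ⋃-head false = ≡.cong (false ∷_) (∪-identityˡ X)

fF≡⋃fF⁅⁆ : ∀ X → fF X ≡ ⋃ (fF ∘ ⁅_⁆) X
fF≡⋃fF⁅⁆ (true  ∷ true  ∷ true  ∷ []) = ≡.refl
fF≡⋃fF⁅⁆ (true  ∷ true  ∷ false ∷ []) = ≡.refl
fF≡⋃fF⁅⁆ (true  ∷ false ∷ true  ∷ []) = ≡.refl
fF≡⋃fF⁅⁆ (true  ∷ false ∷ false ∷ []) = ≡.refl
fF≡⋃fF⁅⁆ (false ∷ true  ∷ true  ∷ []) = ≡.refl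
fF≡⋃fF⁅⁆ (false ∷ true  ∷ false ∷ []) = ≡.refl
fF≡⋃fF⁅⁆ (false ∷ false ∷ true  ∷ []) = ≡.refl
fF≡⋃fF⁅⁆ (false ∷ false ∷ false ∷ []) = ≡.refl

module _ {c ℓ : Level} (A : ClosureAlgebra c ℓ) where
  open ClosureAlgebra A

  -- In B_F, cv {w} = {u,v} and cw {w} = {u,w}, whose atoms are the three singletons.
  cv cw : Carrier → Carrier
  cv x = f (¬ f x)
  cw x = f (¬ cv x)

  forkAtoms : Carrier → Carrier → Fin 3 → Carrier
  forkAtoms a b zero             = a ∧ b
  forkAtoms a b (suc zero)       = a ∧ ¬ b
  forkAtoms a b (suc (suc zero)) = b ∧ ¬ a

  forkHom : Carrier → Subset 3 → Carrier
  forkHom x = Join.⋁ booleanAlgebra (forkAtoms (cv x) (cw x))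

module ClosureAlgebraProperties {c ℓ : Level} (A : ClosureAlgebra c ℓ) where
  open ClosureAlgebra A hiding (_≤_)
  open BooleanAlgebraOrder booleanAlgebra
  open Join booleanAlgebra
  open Partition booleanAlgebra
  open import Relation.Binary.Reasoning.Setoid setoid

  x≤fx : ∀ x → x ≤ f x
  x≤fx x = x∨y≈y⇒x≤y (f-incr x)

  f-monotone : ∀ {x y} → x ≤ y → f x ≤ f y
  f-monotone {x} {y} x≤y = x∨y≈y⇒x≤y (trans (sym (f-join x y)) (f-cong (x≤y⇒x∨y≈y x≤y)))

  f-idempotent : ∀ x → f (f x) ≈ f x
  f-idempotent x = ≤-antisym (x∨y≈y⇒x≤y (f-idem x)) (x≤fx (f x))

  f-squeeze : ∀ {x y} → x ≤ y → f y ≈ y → y ≤ f x → f x ≈ y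
  f-squeeze x≤y fy≈y y≤fx = ≤-antisym (≤-trans (f-monotone x≤y) (≤-reflexive fy≈y)) y≤fx

  f-∧-closed : ∀ {x y} → f x ≈ x → f y ≈ y → f (x ∧ y) ≈ x ∧ y
  f-∧-closed {x} {y} fx≈x fy≈y = ≤-antisym
    (∧-greatest (≤-trans (f-monotone (x∧y≤x x y)) (≤-reflexive fx≈x))
                (≤-trans (f-monotone (x∧y≤y x y)) (≤-reflexive fy≈y)))
    (x≤fx (x ∧ y))

  RespectsFork : (Fin 3 → Carrier) → Set ℓ
  RespectsFork e = ∀ i → f (e i) ≈ ⋁ e (fF ⁅ i ⁆)

  f-⋁ : ∀ {e : Fin 3 → Carrier} → RespectsFork e → ∀ X → f (⋁ e X) ≈ ⋁ e (fF X)
  f-⋁ {e} respects X = begin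
    f (⋁ e X)
      ≈⟨ ⋁-natural booleanAlgebra booleanAlgebra f f-zero f-join e X ⟩
    ⋁ (f ∘ e) X
      ≈⟨ ⋁-cong respects X ⟩
    ⋁ (⋁ e ∘ fF ∘ ⁅_⁆) X
      ≈⟨ ⋁-natural (∪-∩-booleanAlgebra 3) booleanAlgebra (⋁ e) (⋁-⊥ e) (⋁-∪ e) (fF ∘ ⁅_⁆) X ⟨
    ⋁ e (⋃ (fF ∘ ⁅_⁆) X)
      ≈⟨ reflexive (≡.cong (⋁ e) (fF≡⋃fF⁅⁆ X)) ⟨
    ⋁ e (fF X) ∎

  ⋁-isHomomorphism : ∀ {e : Fin 3 → Carrier} → IsPartition e → RespectsFork e →
                     IsHomomorphism B-F A (⋁ e)
  ⋁-isHomomorphism {e} partition respects = record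
    { cong  = λ { ≡.refl → refl }
    ; ∨-hom = ⋁-∪ e
    ; ∧-hom = ⋁-∩ (IsPartition.disjoint partition)
    ; ¬-hom = ⋁-∁ partition
    ; ⊤-hom = IsPartition.cover partition
    ; ⊥-hom = ⋁-⊥ e
    ; f-hom = λ X → sym (f-⋁ respects X)
    }

  module _ {a b : Carrier} where
    private
      e = forkAtoms A a b

    forkAtoms-isPartition : ¬ a ≤ b → IsPartition e
    forkAtoms-isPartition ¬a≤b = record { disjoint = disjoint ; cover = cover }
      where
      disjoint-uv : e zero ∧ e (suc zero) ≈ ⊥
      disjoint-uv = ≤-¬-disjoint (x∧y≤y a b) (x∧y≤y a (¬ b))
      disjoint-uw : e zero ∧ e (suc (suc zero)) ≈ ⊥
      disjoint-uw = ≤-¬-disjoint (x∧y≤x a b) (x∧y≤y b (¬ a))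
      disjoint-wv : e (suc (suc zero)) ∧ e (suc zero) ≈ ⊥
      disjoint-wv = ≤-¬-disjoint (x∧y≤x b (¬ a)) (x∧y≤y a (¬ b))

      disjoint : Disjoint e
      disjoint {zero}             {zero}             i≢i = ⊥-elim (i≢i ≡.refl)
      disjoint {zero}             {suc zero}         _   = disjoint-uv
      disjoint {zero}             {suc (suc zero)}   _   = disjoint-uw
      disjoint {suc zero}         {zero}             _   = trans (∧-comm _ _) disjoint-uv
      disjoint {suc zero}         {suc zero}         i≢i = ⊥-elim (i≢i ≡.refl)
      disjoint {suc zero}         {suc (suc zero)}   _   = trans (∧-comm _ _) disjoint-wv
      disjoint {suc (suc zero)}   {zero}             _   = trans (∧-comm _ _) disjoint-uw
      disjoint {suc (suc zero)}   {suc zero}         _   = disjoint-wv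
      disjoint {suc (suc zero)}   {suc (suc zero)}   i≢i = ⊥-elim (i≢i ≡.refl)

      cover : ⋁ e Subset.⊤ ≈ ⊤
      cover = begin
        ⋁ e ((⁅ u ⁆ ∪ ⁅ v ⁆) ∪ ⁅ w ⁆)          ≈⟨ ⋁-∪ e (⁅ u ⁆ ∪ ⁅ v ⁆) ⁅ w ⁆ ⟩
        ⋁ e (⁅ u ⁆ ∪ ⁅ v ⁆) ∨ ⋁ e ⁅ w ⁆        ≈⟨ ∨-cong (⋁-⁅⁆∪⁅⁆ e u v) (⋁-⁅⁆ e w) ⟩
        ((a ∧ b) ∨ (a ∧ ¬ b)) ∨ (b ∧ ¬ a)      ≈⟨ ∨-congʳ (∧-¬-split a b) ⟩
        a ∨ (b ∧ ¬ a)                          ≈⟨ ¬x≤y⇒x∨y≈⊤ (∧-greatest ¬a≤b ≤-refl) ⟩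
        ⊤                                      ∎

    forkAtoms-respectsFork : f a ≈ a → f b ≈ b → a ≤ f (a ∧ ¬ b) → b ≤ f (b ∧ ¬ a) →
                             RespectsFork e
    forkAtoms-respectsFork fa≈a fb≈b _ _ zero = trans (f-∧-closed fa≈a fb≈b) (sym (⋁-⁅⁆ e u))
    forkAtoms-respectsFork fa≈a _ a≤fv _ (suc zero) = begin
      f (a ∧ ¬ b)                  ≈⟨ f-squeeze (x∧y≤x a (¬ b)) fa≈a a≤fv ⟩
      a                            ≈⟨ ∧-¬-split a b ⟨
      (a ∧ b) ∨ (a ∧ ¬ b)          ≈⟨ ⋁-⁅⁆∪⁅⁆ e u v ⟨
      ⋁ e (⁅ u ⁆ ∪ ⁅ v ⁆)          ∎
    forkAtoms-respectsFork _ fb≈b _ b≤fw (suc (suc zero)) = begin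
      f (b ∧ ¬ a)                  ≈⟨ f-squeeze (x∧y≤x b (¬ a)) fb≈b b≤fw ⟩
      b                            ≈⟨ ∧-¬-split b a ⟨
      (b ∧ a) ∨ (b ∧ ¬ a)          ≈⟨ ∨-congʳ (∧-comm b a) ⟩
      (a ∧ b) ∨ (b ∧ ¬ a)          ≈⟨ ⋁-⁅⁆∪⁅⁆ e u w ⟨
      ⋁ e (⁅ u ⁆ ∪ ⁅ w ⁆)          ∎

  module _ (x : Carrier) where

    cv-closed : f (cv A x) ≈ cv A x
    cv-closed = f-idempotent (¬ f x)

    cw-closed : f (cw A x) ≈ cw A x
    cw-closed = f-idempotent (¬ cv A x)

    ¬cv≤cw : ¬ cv A x ≤ cw A x
    ¬cv≤cw = x≤fx (¬ cv A x)

    cw≤fx : cw A x ≤ f x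
    cw≤fx = ≤-trans (f-monotone (¬x≤y⇒¬y≤x (x≤fx (¬ f x)))) (≤-reflexive (f-idempotent x))

    cv≤f[cv∧¬cw] : cv A x ≤ f (cv A x ∧ ¬ cw A x)
    cv≤f[cv∧¬cw] = f-monotone (∧-greatest (x≤fx (¬ f x)) (¬-antitone cw≤fx))

    cw≤f[cw∧¬cv] : cw A x ≤ f (cw A x ∧ ¬ cv A x)
    cw≤f[cw∧¬cv] = f-monotone (∧-greatest ¬cv≤cw ≤-refl)

    forkHom-isHomomorphism : IsHomomorphism B-F A (forkHom A x)
    forkHom-isHomomorphism = ⋁-isHomomorphism
      (forkAtoms-isPartition ¬cv≤cw)
      (forkAtoms-respectsFork cv-closed cw-closed cv≤f[cv∧¬cw] cw≤f[cw∧¬cv])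

module _ {c₁ ℓ₁ c₂ ℓ₂ : Level} {A : ClosureAlgebra c₁ ℓ₁} {B : ClosureAlgebra c₂ ℓ₂}
         {h : ClosureAlgebra.Carrier A → ClosureAlgebra.Carrier B} (h-hom : IsHomomorphism A B h) where
  private
    module A = ClosureAlgebra A
    module B = ClosureAlgebra B
  open IsHomomorphism h-hom
  open B using (trans; f-cong; ¬-cong; ∧-cong)

  cv-hom : ∀ x → h (cv A x) B.≈ cv B (h x)
  cv-hom x = trans (f-hom _) (f-cong (trans (¬-hom _) (¬-cong (f-hom x))))

  cw-hom : ∀ x → h (cw A x) B.≈ cw B (h x)
  cw-hom x = trans (f-hom _) (f-cong (trans (¬-hom _) (¬-cong (cv-hom x))))

  forkAtoms-hom : ∀ {a b a′ b′} → h a B.≈ a′ → h b B.≈ b′ →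
                  ∀ i → h (forkAtoms A a b i) B.≈ forkAtoms B a′ b′ i
  forkAtoms-hom ha≈a′ hb≈b′ zero             = trans (∧-hom _ _) (∧-cong ha≈a′ hb≈b′)
  forkAtoms-hom ha≈a′ hb≈b′ (suc zero)       =
    trans (∧-hom _ _) (∧-cong ha≈a′ (trans (¬-hom _) (¬-cong hb≈b′)))
  forkAtoms-hom ha≈a′ hb≈b′ (suc (suc zero)) =
    trans (∧-hom _ _) (∧-cong hb≈b′ (trans (¬-hom _) (¬-cong ha≈a′)))

  forkHom-natural : ∀ x X → h (forkHom A x X) B.≈ forkHom B (h x) X
  forkHom-natural x X = trans
    (⋁-natural A.booleanAlgebra B.booleanAlgebra h ⊥-hom ∨-hom _ X)
    (Join.⋁-cong B.booleanAlgebra (forkAtoms-hom (cv-hom x) (cw-hom x)) X)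

forkHom-⁅w⁆ : ∀ X → forkHom B-F ⁅ w ⁆ X ≡ X
forkHom-⁅w⁆ X = ≡.trans (Join.⋁-cong (∪-∩-booleanAlgebra 3) forkAtoms-⁅w⁆ X) (⋃-⁅⁆ X)
  where
  forkAtoms-⁅w⁆ : ∀ i → forkAtoms B-F (cv B-F ⁅ w ⁆) (cw B-F ⁅ w ⁆) i ≡ ⁅ i ⁆
  forkAtoms-⁅w⁆ zero             = ≡.refl
  forkAtoms-⁅w⁆ (suc zero)       = ≡.refl
  forkAtoms-⁅w⁆ (suc (suc zero)) = ≡.refl

mainTheorem11 : ∀ {c ℓ : Level} → Projective c ℓ B-F
mainTheorem11 A p p-hom p-surjective =
  forkHom A x , ClosureAlgebraProperties.forkHom-isHomomorphism A x , p∘q≡id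
  where
  open ≡.≡-Reasoning
  x = proj₁ (p-surjective ⁅ w ⁆)

  p∘q≡id : ∀ X → p (forkHom A x X) ≡ X
  p∘q≡id X = begin
    p (forkHom A x X)     ≡⟨ forkHom-natural p-hom x X ⟩
    forkHom B-F (p x) X   ≡⟨ ≡.cong (λ y → forkHom B-F y X) (proj₂ (p-surjective ⁅ w ⁆)) ⟩
    forkHom B-F ⁅ w ⁆ X   ≡⟨ forkHom-⁅w⁆ X ⟩
    X                     ∎
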